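{- Let $(A,P_A)$, $(B,P_B)$, $(C,P_C)$ be finite strict posets. Then $$\#\{f\in\mathrm{Mor}(P_A,P_B):(f(A),P_B\cap(f(A)\times f(A)))\cong(C,P_C)\}=\frac{|\mathrm{Epi}(P_A,P_C)|\cdot|\mathrm{RegMono}(P_C,P_B)|}{|\mathrm{Aut}(P_C)|},$$ and $$\#\{f\in\mathrm{Mor}(P_A,P_B):(f(A),\mathrm{Tr}(f(P_A)))\cong(C,P_C)\}=\frac{|\mathrm{RegEpi}(P_A,P_C)|\cdot|\mathrm{Mono}(P_C,P_B)|}{|\mathrm{Aut}(P_C)|}.$$
   Context: $\mathsf{PoSet}$ is the category whose objects are finite sets with a strict partial order (asymmetric, transitive relation) and whose morphisms are strictly order-preserving maps ($(a,a')\in P_A\Rightarrow(f(a),f(a'))\in P_B$). $\mathrm{Mor},\mathrm{Mono},\mathrm{Epi},\mathrm{Aut}$ denote morphisms, monomorphisms, epimorphisms, automorphisms in this category; $\mathrm{RegMono}$ regular monomorphisms (equalizers of some parallel pair), $\mathrm{RegEpi}$ regular epimorphisms (coequalizers of some parallel pair). $f(P_A)=\{(f(a),f(a')):(a,a')\in P_A\}$ and $\mathrm{Tr}$ denotes transitive closure. -}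

module Defs where

open import Data.Nat using (ℕ)
open import Data.Fin using (Fin)
open import Data.Vec using (Vec; lookup; tabulate)
open import Data.Bool using (Bool; T)
open import Data.Product using (Σ; ∃; ∃-syntax; _×_; _,_)
open import Data.List using (List; length)
open import Data.List.Membership.Propositional using (_∈_)
open import Data.List.Relation.Unary.Unique.Propositional using (Unique)
open import Relation.Binary.PropositionalEquality using (_≡_)
open import Relation.Binary.Construct.Closure.Transitive using (TransClosure)
open import Relation.Nullary using (¬_)
open import Function.Bundles using (_⇔_)
open import Function using (id)
open import Level using (Level)

record FinPoset : Set where
  field
    size  : ℕ
    rel   : Fin size → Fin size → Bool
    asym  : ∀ {a b} → T (rel a b) → ¬ T (rel b a)
    trans : ∀ {a b c} → T (rel a b) → T (rel b c) → T (rel a c)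

open FinPoset public

_∋_≺_ : (P : FinPoset) → Fin (size P) → Fin (size P) → Set
P ∋ a ≺ b = T (rel P a b)

Map : FinPoset → FinPoset → Set
Map P Q = Vec (Fin (size Q)) (size P)

comp : {P Q R : FinPoset} → Map Q R → Map P Q → Map P R
comp g f = tabulate (λ a → lookup g (lookup f a))

idMap : (P : FinPoset) → Map P P
idMap P = tabulate id

IsMor : (P Q : FinPoset) → Map P Q → Set
IsMor P Q f = ∀ a a' → P ∋ a ≺ a' → Q ∋ lookup f a ≺ lookup f a'

IsMono : (P Q : FinPoset) → Map P Q → Set
IsMono P Q f = IsMor P Q f ×
  ((X : FinPoset) (g h : Map X P) → IsMor X P g → IsMor X P h →
     comp {X} {P} {Q} f g ≡ comp {X} {P} {Q} f h → g ≡ h)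

IsEpi : (P Q : FinPoset) → Map P Q → Set
IsEpi P Q f = IsMor P Q f ×
  ((X : FinPoset) (g h : Map Q X) → IsMor Q X g → IsMor Q X h →
     comp {P} {Q} {X} g f ≡ comp {P} {Q} {X} h f → g ≡ h)

IsAut : (P : FinPoset) → Map P P → Set
IsAut P f = IsMor P P f ×
  (∃[ g ] (IsMor P P g × comp {P} {P} {P} g f ≡ idMap P × comp {P} {P} {P} f g ≡ idMap P))

IsRegMono : (P Q : FinPoset) → Map P Q → Set
IsRegMono P Q f = IsMor P Q f ×
  (∃[ Y ] ∃[ g ] ∃[ h ]
    (IsMor Q Y g × IsMor Q Y h × comp {P} {Q} {Y} g f ≡ comp {P} {Q} {Y} h f ×
     ((X : FinPoset) (k : Map X Q) → IsMor X Q k →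
        comp {X} {Q} {Y} g k ≡ comp {X} {Q} {Y} h k →
        ∃[ u ] (IsMor X P u × comp {X} {P} {Q} f u ≡ k ×
                ((u' : Map X P) → IsMor X P u' → comp {X} {P} {Q} f u' ≡ k → u' ≡ u)))))

IsRegEpi : (P Q : FinPoset) → Map P Q → Set
IsRegEpi P Q f = IsMor P Q f ×
  (∃[ Y ] ∃[ g ] ∃[ h ]
    (IsMor Y P g × IsMor Y P h × comp {Y} {P} {Q} f g ≡ comp {Y} {P} {Q} f h ×
     ((X : FinPoset) (k : Map P X) → IsMor P X k →
        comp {Y} {P} {X} k g ≡ comp {Y} {P} {X} k h →
        ∃[ u ] (IsMor Q X u × comp {P} {Q} {X} u f ≡ k ×
                ((u' : Map Q X) → IsMor Q X u' → comp {P} {Q} {X} u' f ≡ k → u' ≡ u)))))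

InImage : (A B : FinPoset) → Map A B → Fin (size B) → Set
InImage A B f b = ∃[ a ] lookup f a ≡ b

ImRel : (A B : FinPoset) → Map A B → Fin (size B) → Fin (size B) → Set
ImRel A B f b b' = ∃[ a ] ∃[ a' ] (A ∋ a ≺ a' × lookup f a ≡ b × lookup f a' ≡ b')

-- (f(A), R restricted to f(A)) ≅ (C, P_C): there is an order isomorphism
-- from C onto the subset f(A), i.e. an injective map h : C → B with image
-- exactly f(A) such that c ≺_C c' iff R (h c) (h c').
ImageIso : (A B C : FinPoset) → Map A B →
           (Fin (size B) → Fin (size B) → Set) → Set
ImageIso A B C f R = ∃[ h ]
  (((c c' : Fin (size C)) → lookup {n = size C} h c ≡ lookup h c' → c ≡ c') ×
   ((b : Fin (size B)) → InImage A B f b ⇔ (∃[ c ] lookup {n = size C} h c ≡ b)) ×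
   ((c c' : Fin (size C)) → (C ∋ c ≺ c') ⇔ R (lookup h c) (lookup h c')))

InducedIso : (A B C : FinPoset) → Map A B → Set
InducedIso A B C f = ImageIso A B C f (λ b b' → B ∋ b ≺ b')

TrIso : (A B C : FinPoset) → Map A B → Set
TrIso A B C f = ImageIso A B C f (TransClosure (ImRel A B f))

HasCount : {ℓ : Level} {X : Set} → (X → Set ℓ) → ℕ → Set ℓ
HasCount {X = X} Q k = ∃[ L ] (Unique L × ((x : X) → (x ∈ L) ⇔ Q x) × length L ≡ k)

{-# OPTIONS --safe #-}
module Submission where

-- In both counts every f of the left-hand class factors as f = m ∘ e through C: in the first,
-- e is an epimorphism (a surjective morphism) and m a regular monomorphism (an order embedding);
-- in the second, e is a regular epimorphism (surjective with P_C = Tr(e(P_A))) and m a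
-- monomorphism (an injective morphism). Two such factorizations of the same f differ by a unique
-- automorphism of C, so once a factorization (e_f , m_f) is fixed for every f,
-- (f , σ) ↦ (σ ∘ e_f , m_f ∘ σ⁻¹) is a bijection from {f} × Aut(C) onto Epi × RegMono,
-- respectively RegEpi × Mono.

open import Defs renaming (trans to ≺-trans; asym to ≺-asym)
open import Level using (Level)
open import Function using (id; flip; _∘_)
open import Function.Bundles using (_⇔_; mk⇔; Equivalence)
open import Function.Definitions using (Injective; StrictlySurjective)
open import Data.Empty using (⊥; ⊥-elim)
open import Data.Unit using (tt)
open import Data.Bool using (Bool; true; false; T)
open import Data.Sum using (_⊎_; inj₁; inj₂; [_,_]′)
open import Data.Product using (∃; ∃-syntax; _×_; _,_; proj₁; proj₂)
open import Data.Nat using (ℕ; _*_; _+_; _≤_)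
open import Data.Nat.Properties using (≤-antisym)
open import Data.Fin using (Fin; zero; suc; _↑ˡ_; _↑ʳ_; splitAt)
open import Data.Fin.Properties using (injective⇒≤; any?; splitAt-↑ˡ; splitAt-↑ʳ) renaming (_≟_ to _≟ᶠ_)
open import Data.Fin.Induction using (spo-noetherian)
open import Data.Vec using (Vec; []; _∷_; lookup; tabulate)
open import Data.Vec.Properties using (lookup∘tabulate; tabulate∘lookup; tabulate-cong; ≡-dec)
open import Data.List as List using (List; []; _∷_; length; cartesianProduct)
open import Data.List.Properties using (length-++; length-map)
open import Data.List.Membership.Propositional using (_∈_)
open import Data.List.Membership.Propositional.Properties using (∈-lookup; ∈-cartesianProduct⁺; ∈-cartesianProduct⁻)
open import Data.List.Relation.Unary.Any as Any using ()
open import Data.List.Relation.Unary.Any.Properties using (lookup-index)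
open import Data.List.Relation.Unary.All as All using ()
open import Data.List.Relation.Unary.AllPairs using (_∷_)
open import Data.List.Relation.Unary.Unique.Propositional using (Unique)
open import Data.List.Relation.Unary.Unique.Propositional.Properties using (cartesianProduct⁺)
open import Relation.Nullary using (¬_; Dec; yes; no; map′)
open import Relation.Nullary.Decidable using (⌊_⌋; toWitness; fromWitness; _×-dec_; _⊎-dec_)
open import Relation.Nullary.Decidable.Core using (T?)
open import Relation.Binary.Core using (Rel; _=[_]⇒_)
open import Relation.Binary.Definitions using (Decidable; DecidableEquality)
open import Relation.Binary.Structures using (IsStrictPartialOrder)
open import Relation.Binary.Construct.Closure.Transitive using (TransClosure; [_]; _∷_; _++_; transitive⁻)
open import Relation.Binary.PropositionalEquality
open import Induction.WellFounded using (WellFounded; Acc; acc; module Subrelation)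

open Equivalence using (to; from)

private
  variable
    ℓ ℓ′ : Level
    X Y : Set

Unique-lookup-injective : {xs : List X} → Unique xs → Injective _≡_ _≡_ (List.lookup xs)
Unique-lookup-injective (_    ∷ _)   {zero}  {zero}  _  = refl
Unique-lookup-injective (x∉xs ∷ _)   {zero}  {suc j} eq = ⊥-elim (All.lookup x∉xs (∈-lookup j) eq)
Unique-lookup-injective (x∉xs ∷ _)   {suc i} {zero}  eq = ⊥-elim (All.lookup x∉xs (∈-lookup i) (sym eq))
Unique-lookup-injective (_    ∷ xs!) {suc i} {suc j} eq = cong suc (Unique-lookup-injective xs! eq)

HasCount-≤ : {P : X → Set ℓ} {Q : Y → Set ℓ′} {n m : ℕ} → HasCount P n → HasCount Q m →
             (φ : ∀ x → P x → Y) → (∀ x p → Q (φ x p)) →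
             (∀ x p x′ p′ → φ x p ≡ φ x′ p′ → x ≡ x′) → n ≤ m
HasCount-≤ {Y = Y} (L , L! , L⇔P , refl) (M , _ , M⇔Q , refl) φ φ-Q φ-injective = injective⇒≤ index-injective
  where
  image : Fin (length L) → Y
  image i = φ (List.lookup L i) (to (L⇔P _) (∈-lookup i))

  image∈M : ∀ i → image i ∈ M
  image∈M i = from (M⇔Q _) (φ-Q _ _)

  index : Fin (length L) → Fin (length M)
  index i = Any.index (image∈M i)

  index-injective : Injective _≡_ _≡_ index
  index-injective {i} {j} eq = Unique-lookup-injective L! (φ-injective _ _ _ _ (begin
    image i                  ≡⟨ lookup-index (image∈M i) ⟩
    List.lookup M (index i)  ≡⟨ cong (List.lookup M) eq ⟩
    List.lookup M (index j)  ≡⟨ lookup-index (image∈M j) ⟨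
    image j                  ∎))
    where open ≡-Reasoning

length-cartesianProduct : (xs : List X) (ys : List Y) →
                          length (cartesianProduct xs ys) ≡ length xs * length ys
length-cartesianProduct []       ys = refl
length-cartesianProduct (x ∷ xs) ys = begin
  length (List.map (x ,_) ys List.++ cartesianProduct xs ys)  ≡⟨ length-++ (List.map (x ,_) ys) ⟩
  length (List.map (x ,_) ys) + length (cartesianProduct xs ys)
    ≡⟨ cong₂ _+_ (length-map (x ,_) ys) (length-cartesianProduct xs ys) ⟩
  length ys + length xs * length ys                            ∎
  where open ≡-Reasoning

HasCount-× : {P : X → Set ℓ} {Q : Y → Set ℓ′} {n m : ℕ} → HasCount P n → HasCount Q m →
             HasCount (λ (z : X × Y) → P (proj₁ z) × Q (proj₂ z)) (n * m)
HasCount-× {P = P} {Q} (L , L! , L⇔P , refl) (M , M! , M⇔Q , refl) =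
  cartesianProduct L M , cartesianProduct⁺ L! M! , L×M⇔P×Q , length-cartesianProduct L M
  where
  L×M⇔P×Q : ∀ z → (z ∈ cartesianProduct L M) ⇔ (P (proj₁ z) × Q (proj₂ z))
  L×M⇔P×Q (x , y) = mk⇔
    (λ z∈L×M → let x∈L , y∈M = ∈-cartesianProduct⁻ L M z∈L×M in to (L⇔P x) x∈L , to (M⇔Q y) y∈M)
    (λ (p , q) → ∈-cartesianProduct⁺ (from (L⇔P x) p) (from (M⇔Q y) q))

module Canonical {P : X → Set ℓ} {n : ℕ} (_≟_ : DecidableEquality X) (count : HasCount P n) where

  private
    L : List X
    L = proj₁ count
    L⇔P : ∀ x → (x ∈ L) ⇔ P x
    L⇔P = proj₁ (proj₂ (proj₂ count))
    open import Data.List.Membership.DecPropositional _≟_ using (_∈?_)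

  canonical : ∀ {x} → P x → P x
  canonical {x} p with x ∈? L
  ... | yes x∈L = to (L⇔P x) x∈L
  ... | no  _   = p

  canonical-irrelevant : ∀ {x} (p q : P x) → canonical p ≡ canonical q
  canonical-irrelevant {x} p q with x ∈? L
  ... | yes _   = refl
  ... | no  x∉L = ⊥-elim (x∉L (from (L⇔P x) p))

infixl 30 _!_
_!_ : ∀ {n} → Vec X n → Fin n → X
_!_ = lookup

infixr 9 _∘ᵛ_
_∘ᵛ_ : ∀ {k m n} → Vec (Fin k) m → Vec (Fin m) n → Vec (Fin k) n
g ∘ᵛ f = tabulate (λ a → g ! (f ! a))

Surjectiveᵛ : ∀ {m n} → Vec (Fin m) n → Set
Surjectiveᵛ f = StrictlySurjective _≡_ (f !_)

Injectiveᵛ : ∀ {m n} → Vec (Fin m) n → Set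
Injectiveᵛ f = Injective _≡_ _≡_ (f !_)

Vec-ext : ∀ {n} {u v : Vec X n} → (∀ i → u ! i ≡ v ! i) → u ≡ v
Vec-ext {u = u} {v} u≗v = begin
  u                 ≡⟨ tabulate∘lookup u ⟨
  tabulate (u !_)   ≡⟨ tabulate-cong u≗v ⟩
  tabulate (v !_)   ≡⟨ tabulate∘lookup v ⟩
  v                 ∎
  where open ≡-Reasoning

∘ᵛ-! : ∀ {k m n} (g : Vec (Fin k) m) (f : Vec (Fin m) n) a → (g ∘ᵛ f) ! a ≡ g ! (f ! a)
∘ᵛ-! g f = lookup∘tabulate _

idMap-! : ∀ P (a : Fin (size P)) → idMap P ! a ≡ a
idMap-! P = lookup∘tabulate _

∘ᵛ-assoc : ∀ {k l m n} (h : Vec (Fin k) l) (g : Vec (Fin l) m) (f : Vec (Fin m) n) →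
           h ∘ᵛ (g ∘ᵛ f) ≡ (h ∘ᵛ g) ∘ᵛ f
∘ᵛ-assoc h g f = Vec-ext λ a → begin
  (h ∘ᵛ (g ∘ᵛ f)) ! a  ≡⟨ ∘ᵛ-! h (g ∘ᵛ f) a ⟩
  h ! ((g ∘ᵛ f) ! a)   ≡⟨ cong (h !_) (∘ᵛ-! g f a) ⟩
  h ! (g ! (f ! a))    ≡⟨ ∘ᵛ-! h g (f ! a) ⟨
  (h ∘ᵛ g) ! (f ! a)   ≡⟨ ∘ᵛ-! (h ∘ᵛ g) f a ⟨
  ((h ∘ᵛ g) ∘ᵛ f) ! a  ∎
  where open ≡-Reasoning

surjective-cancelʳ : ∀ {k m n} {g h : Vec (Fin k) m} (f : Vec (Fin m) n) → Surjectiveᵛ f →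
                     (∀ a → g ! (f ! a) ≡ h ! (f ! a)) → g ≡ h
surjective-cancelʳ {g = g} {h} f f-surj gf≗hf = Vec-ext λ b → helper b (f-surj b)
  where
  helper : ∀ b → ∃[ a ] f ! a ≡ b → g ! b ≡ h ! b
  helper b (a , refl) = gf≗hf a

∘ᵛ-surjective : ∀ {k m n} {g : Vec (Fin k) m} {f : Vec (Fin m) n} →
                Surjectiveᵛ g → Surjectiveᵛ f → Surjectiveᵛ (g ∘ᵛ f)
∘ᵛ-surjective {g = g} {f} g-surj f-surj c with g-surj c
... | b , refl with f-surj b
...   | a , refl = a , ∘ᵛ-! g f a

∘ᵛ-injective : ∀ {k m n} {g : Vec (Fin k) m} {f : Vec (Fin m) n} →
               Injectiveᵛ g → Injectiveᵛ f → Injectiveᵛ (g ∘ᵛ f)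
∘ᵛ-injective {g = g} {f} g-inj f-inj {a} {a′} eq =
  f-inj (g-inj (trans (sym (∘ᵛ-! g f a)) (trans eq (∘ᵛ-! g f a′))))

∘ᵛ-≗ : ∀ {k m m′ n} {g : Vec (Fin k) m} {f : Vec (Fin m) n} {g′ : Vec (Fin k) m′} {f′ : Vec (Fin m′) n} →
       g ∘ᵛ f ≡ g′ ∘ᵛ f′ → ∀ a → g ! (f ! a) ≡ g′ ! (f′ ! a)
∘ᵛ-≗ {g = g} {f} {g′} {f′} eq a = trans (sym (∘ᵛ-! g f a)) (trans (cong (_! a) eq) (∘ᵛ-! g′ f′ a))

Reflects : (P Q : FinPoset) → Map P Q → Set
Reflects P Q f = ∀ a a′ → Q ∋ f ! a ≺ f ! a′ → P ∋ a ≺ a′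

IsEmbedding : (P Q : FinPoset) → Map P Q → Set
IsEmbedding P Q f = IsMor P Q f × Injectiveᵛ f × Reflects P Q f

≺-resp : ∀ P {a b a′ b′} → a ≡ a′ → b ≡ b′ → P ∋ a ≺ b → P ∋ a′ ≺ b′
≺-resp P = subst₂ (_∋_≺_ P)

≺-isStrictPartialOrder : (P : FinPoset) → IsStrictPartialOrder _≡_ (_∋_≺_ P)
≺-isStrictPartialOrder P = record
  { isEquivalence = isEquivalence
  ; irrefl        = λ { refl a≺a → ≺-asym P a≺a a≺a }
  ; trans         = ≺-trans P
  ; <-resp-≈      = (λ { refl → id }) , (λ { refl → id })
  }

∘ᵛ-mor : ∀ P Q R {g : Map Q R} {f : Map P Q} → IsMor Q R g → IsMor P Q f → IsMor P R (g ∘ᵛ f)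
∘ᵛ-mor P Q R {g} {f} g-mor f-mor a a′ a≺a′ =
  ≺-resp R (sym (∘ᵛ-! g f a)) (sym (∘ᵛ-! g f a′)) (g-mor _ _ (f-mor a a′ a≺a′))

∘ᵛ-reflects : ∀ P Q R {g : Map Q R} {f : Map P Q} → Reflects Q R g → Reflects P Q f → Reflects P R (g ∘ᵛ f)
∘ᵛ-reflects P Q R {g} {f} g-refl f-refl a a′ gfa≺gfa′ =
  f-refl a a′ (g-refl _ _ (≺-resp R (∘ᵛ-! g f a) (∘ᵛ-! g f a′) gfa≺gfa′))

∘ᵛ-embedding : ∀ P Q R {g : Map Q R} {f : Map P Q} →
               IsEmbedding Q R g → IsEmbedding P Q f → IsEmbedding P R (g ∘ᵛ f)
∘ᵛ-embedding P Q R {g} {f} (g-mor , g-inj , g-refl) (f-mor , f-inj , f-refl) =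
  ∘ᵛ-mor P Q R {g} {f} g-mor f-mor ,
  ∘ᵛ-injective {g = g} {f} g-inj f-inj ,
  ∘ᵛ-reflects P Q R {g} {f} g-refl f-refl

module Aut (P : FinPoset) (σ : Map P P) (σ-aut : IsAut P σ) where

  σ⁻¹ : Map P P
  σ⁻¹ = proj₁ (proj₂ σ-aut)

  σ⁻¹-inverseˡ : ∀ a → σ⁻¹ ! (σ ! a) ≡ a
  σ⁻¹-inverseˡ a =
    trans (sym (∘ᵛ-! σ⁻¹ σ a)) (trans (cong (_! a) (proj₁ (proj₂ (proj₂ (proj₂ σ-aut))))) (idMap-! P a))

  σ⁻¹-inverseʳ : ∀ a → σ ! (σ⁻¹ ! a) ≡ a
  σ⁻¹-inverseʳ a =
    trans (sym (∘ᵛ-! σ σ⁻¹ a)) (trans (cong (_! a) (proj₂ (proj₂ (proj₂ (proj₂ σ-aut))))) (idMap-! P a))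

  σ⁻¹-aut : IsAut P σ⁻¹
  σ⁻¹-aut = let σ-mor , _ , σ⁻¹-mor , σ⁻¹σ≡id , σσ⁻¹≡id = σ-aut in σ⁻¹-mor , σ , σ-mor , σσ⁻¹≡id , σ⁻¹σ≡id

  σ-surjective : Surjectiveᵛ σ
  σ-surjective a = σ⁻¹ ! a , σ⁻¹-inverseʳ a

  σ-embedding : IsEmbedding P P σ
  σ-embedding = proj₁ σ-aut
              , (λ {a} {a′} eq → trans (sym (σ⁻¹-inverseˡ a)) (trans (cong (σ⁻¹ !_) eq) (σ⁻¹-inverseˡ a′)))
              , λ a a′ σa≺σa′ → ≺-resp P (σ⁻¹-inverseˡ a) (σ⁻¹-inverseˡ a′) (proj₁ σ⁻¹-aut _ _ σa≺σa′)

reflecting-cancelˡ : ∀ P Q R {g : Map Q R} {σ : Map P Q} {m : Map P R} →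
                     Reflects Q R g → IsMor P R m → (∀ a → g ! (σ ! a) ≡ m ! a) → IsMor P Q σ
reflecting-cancelˡ P Q R g-reflects m-mor gσ≗m a a′ a≺a′ =
  g-reflects _ _ (≺-resp R (sym (gσ≗m a)) (sym (gσ≗m a′)) (m-mor a a′ a≺a′))

-- Epimorphisms and (regular) monomorphisms

Discrete : ℕ → FinPoset
Discrete n = record { size = n ; rel = λ _ _ → false ; asym = λ () ; trans = λ () }

Arrow : FinPoset
Arrow = record { size = 2 ; rel = rel₂ ; asym = asym₂ ; trans = trans₂ }
  where
  rel₂ : Fin 2 → Fin 2 → Bool
  rel₂ zero (suc zero) = true
  rel₂ _    _          = false
  asym₂ : ∀ {a b} → T (rel₂ a b) → ¬ T (rel₂ b a)
  asym₂ {zero} {suc zero} _ ()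
  trans₂ : ∀ {a b c} → T (rel₂ a b) → T (rel₂ b c) → T (rel₂ a c)
  trans₂ {zero} {suc zero} {zero}     _ ()
  trans₂ {zero} {suc zero} {suc zero} _ ()

↑ˡ≢↑ʳ : ∀ {n} {b b′ : Fin n} → b ↑ˡ n ≡ n ↑ʳ b′ → ⊥
↑ˡ≢↑ʳ {n} {b} {b′} eq with trans (sym (splitAt-↑ˡ n b n)) (trans (cong (splitAt n) eq) (splitAt-↑ʳ n n b′))
... | ()

-- Two morphisms from Q into two copies of Q that agree exactly on the image of f.
module ImagePair {P Q : FinPoset} (f : Map P Q) where

  private
    n : ℕ
    n = size Q

  fold : Fin (n + n) → Fin n
  fold y = [ id , id ]′ (splitAt n y)

  Double : FinPoset
  Double = record { size = n + n ; rel = λ y y′ → rel Q (fold y) (fold y′)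
                  ; asym = ≺-asym Q ; trans = ≺-trans Q }

  section⇒mor : (ι : Map Q Double) → (∀ b → fold (ι ! b) ≡ b) → IsMor Q Double ι
  section⇒mor ι fold∘ι≗id b b′ = ≺-resp Q (sym (fold∘ι≗id b)) (sym (fold∘ι≗id b′))

  copy : ∀ {b} → Dec (InImage P Q f b) → Fin (n + n)
  copy {b} (yes _) = b ↑ˡ n
  copy {b} (no _)  = n ↑ʳ b

  inImage? : ∀ b → Dec (InImage P Q f b)
  inImage? b = any? λ a → f ! a ≟ᶠ b

  ι₁ ι₂ : Map Q Double
  ι₁ = tabulate (_↑ˡ n)
  ι₂ = tabulate (λ b → copy (inImage? b))

  ι₁-! : ∀ b → ι₁ ! b ≡ b ↑ˡ n
  ι₁-! = lookup∘tabulate (_↑ˡ n)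

  ι₂-! : ∀ b → ι₂ ! b ≡ copy (inImage? b)
  ι₂-! = lookup∘tabulate (λ b → copy (inImage? b))

  ι₁-mor : IsMor Q Double ι₁
  ι₁-mor = section⇒mor ι₁ λ b → trans (cong fold (ι₁-! b)) (cong [ id , id ]′ (splitAt-↑ˡ n b n))

  ι₂-mor : IsMor Q Double ι₂
  ι₂-mor = section⇒mor ι₂ λ b → trans (cong fold (ι₂-! b)) (fold-copy (inImage? b))
    where
    fold-copy : ∀ {b} (d : Dec (InImage P Q f b)) → fold (copy d) ≡ b
    fold-copy {b} (yes _) = cong [ id , id ]′ (splitAt-↑ˡ n b n)
    fold-copy {b} (no _)  = cong [ id , id ]′ (splitAt-↑ʳ n n b)

  ι-agree : ∀ a → ι₁ ! (f ! a) ≡ ι₂ ! (f ! a)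
  ι-agree a = trans (ι₁-! (f ! a)) (trans (copy-on-image (inImage? (f ! a))) (sym (ι₂-! (f ! a))))
    where
    copy-on-image : (d : Dec (InImage P Q f (f ! a))) → f ! a ↑ˡ n ≡ copy d
    copy-on-image (yes _)  = refl
    copy-on-image (no ¬im) = ⊥-elim (¬im (a , refl))

  ι∘f-agree : ι₁ ∘ᵛ f ≡ ι₂ ∘ᵛ f
  ι∘f-agree = tabulate-cong ι-agree

  ι-agree⇒inImage : ∀ b → ι₁ ! b ≡ ι₂ ! b → InImage P Q f b
  ι-agree⇒inImage b eq = copy-agree (inImage? b) (trans (sym (ι₁-! b)) (trans eq (ι₂-! b)))
    where
    copy-agree : (d : Dec (InImage P Q f b)) → b ↑ˡ n ≡ copy d → InImage P Q f b
    copy-agree (yes im) _  = im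
    copy-agree (no _)   eq = ⊥-elim (↑ˡ≢↑ʳ eq)

epi⇒surjective : ∀ {P Q} {f : Map P Q} → IsEpi P Q f → Surjectiveᵛ f
epi⇒surjective {P} {Q} {f} (_ , epi) b =
  ι-agree⇒inImage b (cong (_! b) (epi Double ι₁ ι₂ ι₁-mor ι₂-mor ι∘f-agree))
  where open ImagePair {P} {Q} f

surjective⇒epi : ∀ {P Q} {f : Map P Q} → IsMor P Q f → Surjectiveᵛ f → IsEpi P Q f
surjective⇒epi {f = f} f-mor f-surj =
  f-mor , λ _ g h _ _ gf≡hf → surjective-cancelʳ f f-surj (∘ᵛ-≗ {g = g} {f} {h} {f} gf≡hf)

mono⇒injective : ∀ {P Q} {f : Map P Q} → IsMono P Q f → Injectiveᵛ f
mono⇒injective (_ , mono) {a} {a′} fa≡fa′ =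
  cong (_! zero) (mono (Discrete 1) (a ∷ []) (a′ ∷ []) (λ _ _ ()) (λ _ _ ()) (cong (_∷ []) fa≡fa′))

injective⇒mono : ∀ {P Q} {f : Map P Q} → IsMor P Q f → Injectiveᵛ f → IsMono P Q f
injective⇒mono {f = f} f-mor f-inj =
  f-mor , λ _ g h _ _ fg≡fh → Vec-ext λ x → f-inj (∘ᵛ-≗ {g = f} {g} {f} {h} fg≡fh x)

module _ {P Q : FinPoset} {f : Map P Q} where

  regularMono⇒embedding : IsRegMono P Q f → IsEmbedding P Q f
  regularMono⇒embedding (f-mor , _ , g , h , _ , _ , gf≡hf , universal) = f-mor , f-inj , f-reflects
    where
    lift : ∀ X (x : Map X P) → IsMor X Q (f ∘ᵛ x) →
           ∃[ u ] (IsMor X P u × f ∘ᵛ u ≡ f ∘ᵛ x × (∀ u′ → IsMor X P u′ → f ∘ᵛ u′ ≡ f ∘ᵛ x → u′ ≡ u))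
    lift X x fx-mor = universal X (f ∘ᵛ x) fx-mor (begin
      g ∘ᵛ (f ∘ᵛ x)  ≡⟨ ∘ᵛ-assoc g f x ⟩
      (g ∘ᵛ f) ∘ᵛ x  ≡⟨ cong (_∘ᵛ x) gf≡hf ⟩
      (h ∘ᵛ f) ∘ᵛ x  ≡⟨ ∘ᵛ-assoc h f x ⟨
      h ∘ᵛ (f ∘ᵛ x)  ∎)
      where open ≡-Reasoning

    f-inj : Injectiveᵛ f
    f-inj = mono⇒injective {P} {Q} {f} (f-mor , λ X x x′ x-mor x′-mor fx≡fx′ →
      let _ , _ , _ , unique = lift X x (∘ᵛ-mor X P Q {f} {x} f-mor x-mor)
      in trans (unique x x-mor refl) (sym (unique x′ x′-mor (sym fx≡fx′))))

    f-reflects : Reflects P Q f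
    f-reflects a a′ fa≺fa′ =
      let u , u-mor , fu≡fx , _ = lift Arrow x fx-mor
          u≡x = Vec-ext {u = u} {x} λ i → f-inj (∘ᵛ-≗ {g = f} {u} {f} {x} fu≡fx i)
      in subst (IsMor Arrow P) u≡x u-mor zero (suc zero) tt
      where
      x : Map Arrow P
      x = a ∷ a′ ∷ []
      fx-mor : IsMor Arrow Q (f ∘ᵛ x)
      fx-mor zero (suc zero) _ = fa≺fa′

  embedding⇒regularMono : IsEmbedding P Q f → IsRegMono P Q f
  embedding⇒regularMono (f-mor , f-inj , f-reflects) =
    f-mor , Double , ι₁ , ι₂ , ι₁-mor , ι₂-mor , ι∘f-agree , universal
    where
    open ImagePair {P} {Q} f
    universal : (X : FinPoset) (k : Map X Q) → IsMor X Q k → ι₁ ∘ᵛ k ≡ ι₂ ∘ᵛ k →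
                ∃[ u ] (IsMor X P u × f ∘ᵛ u ≡ k × ((u′ : Map X P) → IsMor X P u′ → f ∘ᵛ u′ ≡ k → u′ ≡ u))
    universal X k k-mor ι₁k≡ι₂k = u , u-mor , Vec-ext (λ x → trans (∘ᵛ-! f u x) (fu≗k x)) , unique
      where
      preimage : ∀ x → InImage P Q f (k ! x)
      preimage x = ι-agree⇒inImage (k ! x) (∘ᵛ-≗ {g = ι₁} {k} {ι₂} {k} ι₁k≡ι₂k x)
      u : Map X P
      u = tabulate (proj₁ ∘ preimage)
      fu≗k : ∀ x → f ! (u ! x) ≡ k ! x
      fu≗k x = trans (cong (f !_) (lookup∘tabulate (proj₁ ∘ preimage) x)) (proj₂ (preimage x))
      u-mor : IsMor X P u
      u-mor x x′ x≺x′ = f-reflects _ _ (≺-resp Q (sym (fu≗k x)) (sym (fu≗k x′)) (k-mor x x′ x≺x′))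
      unique : (u′ : Map X P) → IsMor X P u′ → f ∘ᵛ u′ ≡ k → u′ ≡ u
      unique u′ _ fu′≡k = Vec-ext λ x →
        f-inj (trans (sym (∘ᵛ-! f u′ x)) (trans (cong (_! x) fu′≡k) (sym (fu≗k x))))

-- Transitive closure of the image order and regular epimorphisms

TransClosure-map : {R : Rel X ℓ} {S : Rel Y ℓ′} {g : X → Y} →
                   R =[ g ]⇒ S → TransClosure R =[ g ]⇒ TransClosure S
TransClosure-map R⇒S [ r ]    = [ R⇒S r ]
TransClosure-map R⇒S (r ∷ rs) = R⇒S r ∷ TransClosure-map R⇒S rs

TransClosure? : ∀ {n} {R : Rel (Fin n) ℓ} → Decidable R → WellFounded (flip R) → Decidable (TransClosure R)
TransClosure? {R = R} R? wf x y = go x (wf x) y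
  where
  go : ∀ x → Acc (flip R) x → ∀ y → Dec (TransClosure R x y)
  go x (acc rec) y = map′ join split (R? x y ⊎-dec any? step)
    where
    step : ∀ z → Dec (R x z × TransClosure R z y)
    step z with R? x z
    ... | yes r = map′ (r ,_) proj₂ (go z (rec r) y)
    ... | no ¬r = no (¬r ∘ proj₁)
    join : R x y ⊎ ∃[ z ] (R x z × TransClosure R z y) → TransClosure R x y
    join (inj₁ r)            = [ r ]
    join (inj₂ (_ , r , rs)) = r ∷ rs
    split : TransClosure R x y → R x y ⊎ ∃[ z ] (R x z × TransClosure R z y)
    split [ r ]    = inj₁ r
    split (r ∷ rs) = inj₂ (_ , r , rs)

Tr : (A C : FinPoset) → Map A C → Fin (size C) → Fin (size C) → Set
Tr A C e = TransClosure (ImRel A C e)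

Generates : (A C : FinPoset) → Map A C → Set
Generates A C e = ∀ c c′ → C ∋ c ≺ c′ → Tr A C e c c′

module _ {A C : FinPoset} {e : Map A C} where

  ImRel? : Decidable (ImRel A C e)
  ImRel? c c′ = any? λ a → any? λ a′ → T? (rel A a a′) ×-dec (e ! a ≟ᶠ c ×-dec e ! a′ ≟ᶠ c′)

  ImRel⊆≺ : IsMor A C e → ∀ {c c′} → ImRel A C e c c′ → C ∋ c ≺ c′
  ImRel⊆≺ e-mor (a , a′ , a≺a′ , refl , refl) = e-mor a a′ a≺a′

  Tr⊆≺ : IsMor A C e → ∀ {c c′} → Tr A C e c c′ → C ∋ c ≺ c′
  Tr⊆≺ e-mor = transitive⁻ (_∋_≺_ C) (≺-trans C) ∘ TransClosure-map (ImRel⊆≺ e-mor)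

  Tr? : IsMor A C e → Decidable (Tr A C e)
  Tr? e-mor = TransClosure? ImRel?
    (Subrelation.wellFounded (ImRel⊆≺ e-mor) (spo-noetherian (≺-isStrictPartialOrder C)))

TrPoset : (A C : FinPoset) (e : Map A C) → IsMor A C e → FinPoset
TrPoset A C e e-mor = record
  { size  = size C
  ; rel   = λ c c′ → ⌊ Tr? {A} {C} {e} e-mor c c′ ⌋
  ; asym  = λ p q → ≺-asym C (Tr⊆≺′ (toWitness p)) (Tr⊆≺′ (toWitness q))
  ; trans = λ p q → fromWitness (toWitness p ++ toWitness q)
  }
  where
  Tr⊆≺′ : ∀ {c c′} → Tr A C e c c′ → C ∋ c ≺ c′
  Tr⊆≺′ = Tr⊆≺ {A} {C} {e} e-mor

module _ {A B C : FinPoset} {e : Map A C} {f : Map A B} (g : Fin (size C) → Fin (size B))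
         (f≗g∘e : ∀ a → f ! a ≡ g (e ! a)) where

  Tr-map : ∀ {c c′} → Tr A C e c c′ → Tr A B f (g c) (g c′)
  Tr-map = TransClosure-map λ { (a , a′ , a≺a′ , refl , refl) → a , a′ , a≺a′ , f≗g∘e a , f≗g∘e a′ }

  Tr-reflect : Injective _≡_ _≡_ g → ∀ {c c′} → Tr A B f (g c) (g c′) → Tr A C e c c′
  Tr-reflect g-inj = go refl refl
    where
    endpoint : ∀ {a b c} → f ! a ≡ b → b ≡ g c → e ! a ≡ c
    endpoint {a} fa≡b b≡gc = g-inj (trans (sym (f≗g∘e a)) (trans fa≡b b≡gc))
    go : ∀ {b b′ c c′} → b ≡ g c → b′ ≡ g c′ → Tr A B f b b′ → Tr A C e c c′
    go b≡gc b′≡gc′ [ a , a′ , a≺a′ , fa≡b , fa′≡b′ ] =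
      [ a , a′ , a≺a′ , endpoint fa≡b b≡gc , endpoint fa′≡b′ b′≡gc′ ]
    go b≡gc b′≡gc′ ((a , a′ , a≺a′ , fa≡b , fa′≡w) ∷ rs) =
      (a , a′ , a≺a′ , endpoint fa≡b b≡gc , refl) ∷ go (trans (sym fa′≡w) (f≗g∘e a′)) b′≡gc′ rs

generating-cancelʳ : ∀ A C D {e : Map A C} {σ : Map C D} {e′ : Map A D} →
                     Generates A C e → IsMor A D e′ → (∀ a → σ ! (e ! a) ≡ e′ ! a) → IsMor C D σ
generating-cancelʳ A C D {e} {σ} {e′} e-gen e′-mor σe≗e′ c c′ c≺c′ =
  Tr⊆≺ {A} {D} {e′} e′-mor (Tr-map {A} {D} {C} {e} {e′} (σ !_) (sym ∘ σe≗e′) (e-gen c c′ c≺c′))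

module _ {P Q : FinPoset} {f : Map P Q} where

  regularEpi⇒epi : IsRegEpi P Q f → IsEpi P Q f
  regularEpi⇒epi (f-mor , _ , g , h , _ , _ , fg≡fh , universal) = f-mor , λ X x x′ x-mor x′-mor xf≡x′f →
    let _ , _ , _ , unique = universal X (x ∘ᵛ f) (∘ᵛ-mor P Q X {x} {f} x-mor f-mor) (begin
          (x ∘ᵛ f) ∘ᵛ g  ≡⟨ ∘ᵛ-assoc x f g ⟨
          x ∘ᵛ (f ∘ᵛ g)  ≡⟨ cong (x ∘ᵛ_) fg≡fh ⟩
          x ∘ᵛ (f ∘ᵛ h)  ≡⟨ ∘ᵛ-assoc x f h ⟩
          (x ∘ᵛ f) ∘ᵛ h  ∎)
    in trans (unique x x-mor refl) (sym (unique x′ x′-mor (sym xf≡x′f)))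
    where open ≡-Reasoning

  regularEpi⇒surjective : IsRegEpi P Q f → Surjectiveᵛ f
  regularEpi⇒surjective = epi⇒surjective {P} {Q} {f} ∘ regularEpi⇒epi

  -- Tested against Q ordered by Tr P Q f, the coequalizer property makes the identity monotone.
  regularEpi⇒generates : IsRegEpi P Q f → Generates P Q f
  regularEpi⇒generates f-reg@(f-mor , _ , _ , _ , _ , _ , fg≡fh , universal) c c′ c≺c′ =
    let u , u-mor , uf≡f , _ = universal (TrPoset P Q f f-mor) f f-mor′ fg≡fh
    in subst₂ (Tr P Q f) (u≗id {u} uf≡f c) (u≗id {u} uf≡f c′) (toWitness (u-mor c c′ c≺c′))
    where
    f-mor′ : IsMor P (TrPoset P Q f f-mor) f
    f-mor′ a a′ a≺a′ = fromWitness [ a , a′ , a≺a′ , refl , refl ]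
    u≗id : ∀ {u : Map Q Q} → u ∘ᵛ f ≡ f → ∀ c → u ! c ≡ c
    u≗id {u} uf≡f c with regularEpi⇒surjective f-reg c
    ... | a , refl = trans (sym (∘ᵛ-! u f a)) (cong (_! a) uf≡f)

  -- f is the coequalizer of the identity and a ↦ s (f a), for a section s of f.
  surjective⇒regularEpi : IsMor P Q f → Surjectiveᵛ f → Generates P Q f → IsRegEpi P Q f
  surjective⇒regularEpi f-mor f-surj f-gen =
    f-mor , Discrete (size P) , idMap P , g , (λ _ _ ()) , (λ _ _ ()) , Vec-ext f∘id≗f∘g , universal
    where
    s : Fin (size Q) → Fin (size P)
    s = proj₁ ∘ f-surj
    g : Map P P
    g = tabulate (λ a → s (f ! a))
    f∘id≗f∘g : ∀ a → (f ∘ᵛ idMap P) ! a ≡ (f ∘ᵛ g) ! a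
    f∘id≗f∘g a = begin
      (f ∘ᵛ idMap P) ! a  ≡⟨ ∘ᵛ-! f (idMap P) a ⟩
      f ! (idMap P ! a)   ≡⟨ cong (f !_) (idMap-! P a) ⟩
      f ! a               ≡⟨ proj₂ (f-surj (f ! a)) ⟨
      f ! s (f ! a)       ≡⟨ cong (f !_) (lookup∘tabulate (λ a → s (f ! a)) a) ⟨
      f ! (g ! a)         ≡⟨ ∘ᵛ-! f g a ⟨
      (f ∘ᵛ g) ! a        ∎
      where open ≡-Reasoning
    universal : (X : FinPoset) (k : Map P X) → IsMor P X k → k ∘ᵛ idMap P ≡ k ∘ᵛ g →
                ∃[ u ] (IsMor Q X u × u ∘ᵛ f ≡ k × ((u′ : Map Q X) → IsMor Q X u′ → u′ ∘ᵛ f ≡ k → u′ ≡ u))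
    universal X k k-mor k≡k∘g = u , u-mor , Vec-ext (λ a → trans (∘ᵛ-! u f a) (uf≗k a)) , unique
      where
      u : Map Q X
      u = tabulate (λ b → k ! s b)
      uf≗k : ∀ a → u ! (f ! a) ≡ k ! a
      uf≗k a = begin
        u ! (f ! a)        ≡⟨ lookup∘tabulate (λ b → k ! s b) (f ! a) ⟩
        k ! s (f ! a)      ≡⟨ cong (k !_) (lookup∘tabulate (λ a → s (f ! a)) a) ⟨
        k ! (g ! a)        ≡⟨ ∘ᵛ-≗ {g = k} {idMap P} {k} {g} k≡k∘g a ⟨
        k ! (idMap P ! a)  ≡⟨ cong (k !_) (idMap-! P a) ⟩
        k ! a              ∎
        where open ≡-Reasoning
      u-mor : IsMor Q X u
      u-mor b b′ b≺b′ = transitive⁻ (_∋_≺_ X) (≺-trans X) (TransClosure-map step (f-gen b b′ b≺b′))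
        where
        step : ∀ {b b′} → ImRel P Q f b b′ → X ∋ u ! b ≺ u ! b′
        step (a , a′ , a≺a′ , refl , refl) = ≺-resp X (sym (uf≗k a)) (sym (uf≗k a′)) (k-mor a a′ a≺a′)
      unique : (u′ : Map Q X) → IsMor Q X u′ → u′ ∘ᵛ f ≡ k → u′ ≡ u
      unique u′ _ u′f≡k = surjective-cancelʳ f f-surj λ a →
        trans (trans (sym (∘ᵛ-! u′ f a)) (cong (_! a) u′f≡k)) (sym (uf≗k a))

-- Factorizations through C

module _ {A B C : FinPoset} {R : Fin (size B) → Fin (size B) → Set} where

  imageIso : (e : Map A C) (m : Map C B) → Surjectiveᵛ e → Injectiveᵛ m →
             (∀ c c′ → (C ∋ c ≺ c′) ⇔ R (m ! c) (m ! c′)) → ImageIso A B C (m ∘ᵛ e) R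
  imageIso e m e-surj m-inj ≺⇔R = m , (λ _ _ → m-inj) , image-m , ≺⇔R
    where
    image-m : ∀ b → InImage A B (m ∘ᵛ e) b ⇔ (∃[ c ] m ! c ≡ b)
    image-m b = mk⇔ (λ (a , mea≡b) → e ! a , trans (sym (∘ᵛ-! m e a)) mea≡b)
                    (λ (c , mc≡b) → let a , ea≡c = e-surj c in
                                    a , trans (∘ᵛ-! m e a) (trans (cong (m !_) ea≡c) mc≡b))

  module FromImageIso {f : Map A B} (iso : ImageIso A B C f R) where

    h : Map C B
    h = proj₁ iso

    h-injective : Injectiveᵛ h
    h-injective = proj₁ (proj₂ iso) _ _

    ≺⇔R : ∀ c c′ → (C ∋ c ≺ c′) ⇔ R (h ! c) (h ! c′)
    ≺⇔R = proj₂ (proj₂ (proj₂ iso))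

    image-f⇔image-h : ∀ b → InImage A B f b ⇔ (∃[ c ] h ! c ≡ b)
    image-f⇔image-h = proj₁ (proj₂ (proj₂ iso))

    private
      image-f⊆image-h : ∀ a → ∃[ c ] h ! c ≡ f ! a
      image-f⊆image-h a = to (image-f⇔image-h (f ! a)) (a , refl)

    corestriction : Map A C
    corestriction = tabulate (proj₁ ∘ image-f⊆image-h)

    factors : ∀ a → f ! a ≡ h ! (corestriction ! a)
    factors a =
      sym (trans (cong (h !_) (lookup∘tabulate (proj₁ ∘ image-f⊆image-h) a)) (proj₂ (image-f⊆image-h a)))

    corestriction-surjective : Surjectiveᵛ corestriction
    corestriction-surjective c =
      let a , fa≡hc = from (image-f⇔image-h (h ! c)) (c , refl)
      in a , h-injective (trans (sym (factors a)) fa≡hc)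

    corestriction-mor : (∀ a a′ → A ∋ a ≺ a′ → R (f ! a) (f ! a′)) → IsMor A C corestriction
    corestriction-mor f-R a a′ a≺a′ = from (≺⇔R _ _) (subst₂ R (factors a) (factors a′) (f-R a a′ a≺a′))

record Factorization (A B C : FinPoset) (E : Map A C → Set) (M : Map C B → Set) (f : Map A B) : Set where
  field
    left    : Map A C
    right   : Map C B
    left∈E  : E left
    right∈M : M right
    factors : ∀ a → f ! a ≡ right ! (left ! a)

module FactorizationCount
  (A B C : FinPoset) {F : Map A B → Set} {E : Map A C → Set} {M : Map C B → Set}
  (E⇒surjective : ∀ {e} → E e → Surjectiveᵛ e)
  (M⇒injective : ∀ {m} → M m → Injectiveᵛ m)
  (compose : ∀ {e m} → E e → M m → F (m ∘ᵛ e))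
  (factor : ∀ {f} → F f → Factorization A B C E M f)
  (E-∘-aut : ∀ {e σ} → E e → IsAut C σ → E (σ ∘ᵛ e))
  (M-∘-aut : ∀ {m σ} → M m → IsAut C σ → M (m ∘ᵛ σ))
  (comparison-mor : ∀ {e m e′ m′} → E e → M m → E e′ → M m′ → (σ : Map C C) →
                    (∀ a → σ ! (e ! a) ≡ e′ ! a) → (∀ c → m′ ! (σ ! c) ≡ m ! c) → IsMor C C σ)
  where

  open Factorization

  private
    Fact : Map A B → Set
    Fact = Factorization A B C E M

  comparison : ∀ {f} → Fact f → Fact f → Map C C
  comparison φ ψ = tabulate (λ c → left ψ ! proj₁ (E⇒surjective (left∈E φ) c))

  comparison-right : ∀ {f} (φ ψ : Fact f) c → right ψ ! (comparison φ ψ ! c) ≡ right φ ! c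
  comparison-right {f} φ ψ c = begin
    right ψ ! (comparison φ ψ ! c)  ≡⟨ cong (right ψ !_) (lookup∘tabulate _ c) ⟩
    right ψ ! (left ψ ! a)          ≡⟨ factors ψ a ⟨
    f ! a                           ≡⟨ factors φ a ⟩
    right φ ! (left φ ! a)          ≡⟨ cong (right φ !_) (proj₂ (E⇒surjective (left∈E φ) c)) ⟩
    right φ ! c                     ∎
    where
    open ≡-Reasoning
    a : Fin (size A)
    a = proj₁ (E⇒surjective (left∈E φ) c)

  comparison-left : ∀ {f} (φ ψ : Fact f) a → comparison φ ψ ! (left φ ! a) ≡ left ψ ! a
  comparison-left {f} φ ψ a = M⇒injective (right∈M ψ) (begin
    right ψ ! (comparison φ ψ ! (left φ ! a))  ≡⟨ comparison-right φ ψ (left φ ! a) ⟩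
    right φ ! (left φ ! a)                     ≡⟨ factors φ a ⟨
    f ! a                                      ≡⟨ factors ψ a ⟩
    right ψ ! (left ψ ! a)                     ∎)
    where open ≡-Reasoning

  comparison-inverse : ∀ {f} (φ ψ : Fact f) → comparison ψ φ ∘ᵛ comparison φ ψ ≡ idMap C
  comparison-inverse φ ψ = surjective-cancelʳ (left φ) (E⇒surjective (left∈E φ)) λ a → begin
    (τ ∘ᵛ σ) ! (left φ ! a)   ≡⟨ ∘ᵛ-! τ σ (left φ ! a) ⟩
    τ ! (σ ! (left φ ! a))    ≡⟨ cong (τ !_) (comparison-left φ ψ a) ⟩
    τ ! (left ψ ! a)          ≡⟨ comparison-left ψ φ a ⟩
    left φ ! a                ≡⟨ idMap-! C (left φ ! a) ⟨
    idMap C ! (left φ ! a)    ∎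
    where
    open ≡-Reasoning
    σ τ : Map C C
    σ = comparison φ ψ
    τ = comparison ψ φ

  comparison-aut : ∀ {f} (φ ψ : Fact f) → IsAut C (comparison φ ψ)
  comparison-aut φ ψ =
    comparison-mor′ φ ψ , comparison ψ φ , comparison-mor′ ψ φ , comparison-inverse φ ψ , comparison-inverse ψ φ
    where
    comparison-mor′ : ∀ {f} (φ ψ : Fact f) → IsMor C C (comparison φ ψ)
    comparison-mor′ φ ψ = comparison-mor (left∈E φ) (right∈M φ) (left∈E ψ) (right∈M ψ)
                            (comparison φ ψ) (comparison-left φ ψ) (comparison-right φ ψ)

  asFactorization : ∀ {e m} → E e → M m → Fact (m ∘ᵛ e)
  asFactorization {e} {m} pe pm =
    record { left = e ; right = m ; left∈E = pe ; right∈M = pm ; factors = ∘ᵛ-! m e }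

  module _ {n₁ : ℕ} (F-count : HasCount F n₁) where

    open Canonical (≡-dec _≟ᶠ_) F-count

    -- The factorization chosen for f must not depend on the proof of F f, or twist would not be injective.
    canonicalFactor : ∀ {f} → F f → Fact f
    canonicalFactor p = factor (canonical p)

    canonicalFactor-cong : ∀ {f f′} (p : F f) (p′ : F f′) → f ≡ f′ →
                           left (canonicalFactor p) ≡ left (canonicalFactor p′) ×
                           right (canonicalFactor p) ≡ right (canonicalFactor p′)
    canonicalFactor-cong p p′ refl rewrite canonical-irrelevant p p′ = refl , refl

    twist : (z : Map A B × Map C C) → F (proj₁ z) × IsAut C (proj₂ z) → Map A C × Map C B
    twist (f , σ) (p , σ-aut) = σ ∘ᵛ left φ , right φ ∘ᵛ σ⁻¹
      where
      open Aut C σ σ-aut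
      φ : Fact f
      φ = canonicalFactor p

    twist-∈ : ∀ z pz → E (proj₁ (twist z pz)) × M (proj₂ (twist z pz))
    twist-∈ (f , σ) (p , σ-aut) = E-∘-aut {σ = σ} (left∈E φ) σ-aut , M-∘-aut {σ = σ⁻¹} (right∈M φ) σ⁻¹-aut
      where
      open Aut C σ σ-aut
      φ : Fact f
      φ = canonicalFactor p

    twist-factors : ∀ z pz a → proj₁ z ! a ≡ proj₂ (twist z pz) ! (proj₁ (twist z pz) ! a)
    twist-factors (f , σ) (p , σ-aut) a = begin
      f ! a                                   ≡⟨ factors φ a ⟩
      right φ ! (left φ ! a)                  ≡⟨ cong (right φ !_) (σ⁻¹-inverseˡ (left φ ! a)) ⟨
      right φ ! (σ⁻¹ ! (σ ! (left φ ! a)))    ≡⟨ ∘ᵛ-! (right φ) σ⁻¹ (σ ! (left φ ! a)) ⟨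
      (right φ ∘ᵛ σ⁻¹) ! (σ ! (left φ ! a))   ≡⟨ cong ((right φ ∘ᵛ σ⁻¹) !_) (∘ᵛ-! σ (left φ) a) ⟨
      (right φ ∘ᵛ σ⁻¹) ! ((σ ∘ᵛ left φ) ! a)  ∎
      where
      open ≡-Reasoning
      open Aut C σ σ-aut
      φ : Fact f
      φ = canonicalFactor p

    twist-injective : ∀ z pz z′ pz′ → twist z pz ≡ twist z′ pz′ → z ≡ z′
    twist-injective (f , σ) pz@(p , _) (f′ , σ′) pz′@(p′ , _) eq = cong₂ _,_ f≡f′ σ≡σ′
      where
      open ≡-Reasoning
      f≡f′ : f ≡ f′
      f≡f′ = Vec-ext λ a → begin
        f ! a                                                ≡⟨ twist-factors (f , σ) pz a ⟩
        proj₂ (twist (f , σ) pz) ! (proj₁ (twist (f , σ) pz) ! a)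
          ≡⟨ cong (λ (e , m) → m ! (e ! a)) eq ⟩
        proj₂ (twist (f′ , σ′) pz′) ! (proj₁ (twist (f′ , σ′) pz′) ! a)
          ≡⟨ twist-factors (f′ , σ′) pz′ a ⟨
        f′ ! a                                               ∎
      e e′ : Map A C
      e = left (canonicalFactor p)
      e′ = left (canonicalFactor p′)
      σ≡σ′ : σ ≡ σ′
      σ≡σ′ = surjective-cancelʳ e (E⇒surjective (left∈E (canonicalFactor p))) λ a → begin
        σ ! (e ! a)    ≡⟨ ∘ᵛ-≗ {g = σ} {e} {σ′} {e′} (cong proj₁ eq) a ⟩
        σ′ ! (e′ ! a)  ≡⟨ cong (λ e → σ′ ! (e ! a)) (proj₁ (canonicalFactor-cong p p′ f≡f′)) ⟨
        σ′ ! (e ! a)   ∎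

    untwist : (z : Map A C × Map C B) → E (proj₁ z) × M (proj₂ z) → Map A B × Map C C
    untwist (e , m) (pe , pm) = m ∘ᵛ e , comparison (canonicalFactor (compose pe pm)) (asFactorization pe pm)

    untwist-∈ : ∀ z pz → F (proj₁ (untwist z pz)) × IsAut C (proj₂ (untwist z pz))
    untwist-∈ (e , m) (pe , pm) =
      compose pe pm , comparison-aut (canonicalFactor (compose pe pm)) (asFactorization pe pm)

    untwist-injective : ∀ z pz z′ pz′ → untwist z pz ≡ untwist z′ pz′ → z ≡ z′
    untwist-injective (e , m) (pe , pm) (e′ , m′) (pe′ , pm′) eq = cong₂ _,_ e≡e′ m≡m′
      where
      open ≡-Reasoning
      φ : Fact (m ∘ᵛ e)
      φ = canonicalFactor (compose pe pm)
      φ′ : Fact (m′ ∘ᵛ e′)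
      φ′ = canonicalFactor (compose pe′ pm′)
      σ σ′ : Map C C
      σ = comparison φ (asFactorization pe pm)
      σ′ = comparison φ′ (asFactorization pe′ pm′)
      φ≈φ′ : left φ ≡ left φ′ × right φ ≡ right φ′
      φ≈φ′ = canonicalFactor-cong (compose pe pm) (compose pe′ pm′) (cong proj₁ eq)
      e≡e′ : e ≡ e′
      e≡e′ = Vec-ext λ a → begin
        e ! a                     ≡⟨ comparison-left φ (asFactorization pe pm) a ⟨
        σ ! (left φ ! a)          ≡⟨ cong₂ (λ σ e → σ ! (e ! a)) (cong proj₂ eq) (proj₁ φ≈φ′) ⟩
        σ′ ! (left φ′ ! a)        ≡⟨ comparison-left φ′ (asFactorization pe′ pm′) a ⟩
        e′ ! a                    ∎
      m≡m′ : m ≡ m′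
      m≡m′ = surjective-cancelʳ σ (Aut.σ-surjective C σ (comparison-aut φ (asFactorization pe pm))) λ c → begin
        m ! (σ ! c)               ≡⟨ comparison-right φ (asFactorization pe pm) c ⟩
        right φ ! c               ≡⟨ cong (_! c) (proj₂ φ≈φ′) ⟩
        right φ′ ! c              ≡⟨ comparison-right φ′ (asFactorization pe′ pm′) c ⟨
        m′ ! (σ′ ! c)             ≡⟨ cong (λ σ → m′ ! (σ ! c)) (cong proj₂ eq) ⟨
        m′ ! (σ ! c)              ∎

  count : ∀ {n₁ n₂ n₃ n₄} → HasCount F n₁ → HasCount E n₂ → HasCount M n₃ → HasCount (IsAut C) n₄ →
          n₁ * n₄ ≡ n₂ * n₃
  count {n₁} {n₂} {n₃} {n₄} F-count E-count M-count Aut-count = ≤-antisym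
    (HasCount-≤ F×Aut E×M (twist F-count) (twist-∈ F-count) (twist-injective F-count))
    (HasCount-≤ E×M F×Aut (untwist F-count) (untwist-∈ F-count) (untwist-injective F-count))
    where
    F×Aut : HasCount (λ z → F (proj₁ z) × IsAut C (proj₂ z)) (n₁ * n₄)
    F×Aut = HasCount-× F-count Aut-count
    E×M : HasCount (λ z → E (proj₁ z) × M (proj₂ z)) (n₂ * n₃)
    E×M = HasCount-× E-count M-count

module _ (A B C : FinPoset) where

  epi-∘-aut : ∀ {e σ} → IsEpi A C e → IsAut C σ → IsEpi A C (σ ∘ᵛ e)
  epi-∘-aut {e} {σ} e-epi σ-aut =
    surjective⇒epi {A} {C} {σ ∘ᵛ e} (∘ᵛ-mor A C C {σ} {e} (proj₁ σ-aut) (proj₁ e-epi))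
                   (∘ᵛ-surjective {g = σ} {e} (Aut.σ-surjective C σ σ-aut) (epi⇒surjective {A} {C} {e} e-epi))

  regularMono-∘-aut : ∀ {m σ} → IsRegMono C B m → IsAut C σ → IsRegMono C B (m ∘ᵛ σ)
  regularMono-∘-aut {m} {σ} m-reg σ-aut =
    embedding⇒regularMono {C} {B} {m ∘ᵛ σ}
      (∘ᵛ-embedding C C B {m} {σ} (regularMono⇒embedding {C} {B} {m} m-reg) (Aut.σ-embedding C σ σ-aut))

  regularMono-comparison : ∀ {m m′} → IsRegMono C B m → IsRegMono C B m′ → (σ : Map C C) →
                           (∀ c → m′ ! (σ ! c) ≡ m ! c) → IsMor C C σ
  regularMono-comparison {m} {m′} m-reg m′-reg σ =
    reflecting-cancelˡ C C B {m′} {σ} {m} (proj₂ (proj₂ (regularMono⇒embedding {C} {B} {m′} m′-reg)))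
                                         (proj₁ m-reg)

  inducedIso-compose : ∀ {e m} → IsEpi A C e → IsRegMono C B m → IsMor A B (m ∘ᵛ e) × InducedIso A B C (m ∘ᵛ e)
  inducedIso-compose {e} {m} e-epi m-reg =
    let m-mor , m-inj , m-reflects = regularMono⇒embedding {C} {B} {m} m-reg in
    ∘ᵛ-mor A C B {m} {e} m-mor (proj₁ e-epi) ,
    imageIso {A} {B} {C} {λ b b′ → B ∋ b ≺ b′} e m (epi⇒surjective {A} {C} {e} e-epi) m-inj
             (λ c c′ → mk⇔ (m-mor c c′) (m-reflects c c′))

  inducedIso-factor : ∀ {f} → IsMor A B f × InducedIso A B C f →
                      Factorization A B C (IsEpi A C) (IsRegMono C B) f
  inducedIso-factor {f} (f-mor , iso) = record
    { left    = corestriction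
    ; right   = h
    ; left∈E  = surjective⇒epi {A} {C} {corestriction} (corestriction-mor f-mor) corestriction-surjective
    ; right∈M = embedding⇒regularMono {C} {B} {h}
                  ((λ c c′ → to (≺⇔R c c′)) , h-injective , (λ c c′ → from (≺⇔R c c′)))
    ; factors = factors
    }
    where open FromImageIso {A} {B} {C} {λ b b′ → B ∋ b ≺ b′} {f} iso

  inducedIso-count : ∀ {n₁ n₂ n₃ n₄} → HasCount (λ f → IsMor A B f × InducedIso A B C f) n₁ →
                     HasCount (IsEpi A C) n₂ → HasCount (IsRegMono C B) n₃ → HasCount (IsAut C) n₄ →
                     n₁ * n₄ ≡ n₂ * n₃
  inducedIso-count = FactorizationCount.count A B C
    (λ {e} → epi⇒surjective {A} {C} {e})
    (λ {m} m-reg → proj₁ (proj₂ (regularMono⇒embedding {C} {B} {m} m-reg)))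
    (λ {e} {m} → inducedIso-compose {e} {m})
    (λ {f} → inducedIso-factor {f})
    (λ {e} {σ} → epi-∘-aut {e} {σ})
    (λ {m} {σ} → regularMono-∘-aut {m} {σ})
    (λ {m = m} {m′ = m′} _ m-reg _ m′-reg σ _ → regularMono-comparison {m} {m′} m-reg m′-reg σ)

  regularEpi-∘-aut : ∀ {e σ} → IsRegEpi A C e → IsAut C σ → IsRegEpi A C (σ ∘ᵛ e)
  regularEpi-∘-aut {e} {σ} e-reg σ-aut =
    surjective⇒regularEpi {A} {C} {σ ∘ᵛ e} (∘ᵛ-mor A C C {σ} {e} (proj₁ σ-aut) (proj₁ e-reg))
      (∘ᵛ-surjective {g = σ} {e} σ-surjective (regularEpi⇒surjective {A} {C} {e} e-reg)) σe-generates
    where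
    open Aut C σ σ-aut
    σe-generates : Generates A C (σ ∘ᵛ e)
    σe-generates c c′ c≺c′ = subst₂ (Tr A C (σ ∘ᵛ e)) (σ⁻¹-inverseʳ c) (σ⁻¹-inverseʳ c′)
      (Tr-map {A} {C} {C} {e} {σ ∘ᵛ e} (σ !_) (∘ᵛ-! σ e)
        (regularEpi⇒generates {A} {C} {e} e-reg _ _ (proj₁ σ⁻¹-aut c c′ c≺c′)))

  mono-∘-aut : ∀ {m σ} → IsMono C B m → IsAut C σ → IsMono C B (m ∘ᵛ σ)
  mono-∘-aut {m} {σ} m-mono σ-aut =
    injective⇒mono {C} {B} {m ∘ᵛ σ} (∘ᵛ-mor C C B {m} {σ} (proj₁ m-mono) (proj₁ σ-aut))
                   (∘ᵛ-injective {g = m} {σ} (mono⇒injective {C} {B} {m} m-mono)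
                                            (proj₁ (proj₂ (Aut.σ-embedding C σ σ-aut))))

  regularEpi-comparison : ∀ {e e′} → IsRegEpi A C e → IsRegEpi A C e′ → (σ : Map C C) →
                         (∀ a → σ ! (e ! a) ≡ e′ ! a) → IsMor C C σ
  regularEpi-comparison {e} {e′} e-reg e′-reg σ =
    generating-cancelʳ A C C {e} {σ} {e′} (regularEpi⇒generates {A} {C} {e} e-reg) (proj₁ e′-reg)

  trIso-compose : ∀ {e m} → IsRegEpi A C e → IsMono C B m → IsMor A B (m ∘ᵛ e) × TrIso A B C (m ∘ᵛ e)
  trIso-compose {e} {m} e-reg m-mono =
    ∘ᵛ-mor A C B {m} {e} (proj₁ m-mono) (proj₁ e-reg) ,
    imageIso {A} {B} {C} {Tr A B (m ∘ᵛ e)} e m (regularEpi⇒surjective {A} {C} {e} e-reg) m-inj λ c c′ →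
      mk⇔ (Tr-map {A} {B} {C} {e} {m ∘ᵛ e} (m !_) (∘ᵛ-! m e) ∘ regularEpi⇒generates {A} {C} {e} e-reg c c′)
          (Tr⊆≺ {A} {C} {e} (proj₁ e-reg) ∘ Tr-reflect {A} {B} {C} {e} {m ∘ᵛ e} (m !_) (∘ᵛ-! m e) m-inj)
    where
    m-inj : Injectiveᵛ m
    m-inj = mono⇒injective {C} {B} {m} m-mono

  trIso-factor : ∀ {f} → IsMor A B f × TrIso A B C f →
                 Factorization A B C (IsRegEpi A C) (IsMono C B) f
  trIso-factor {f} (f-mor , iso) = record
    { left    = corestriction
    ; right   = h
    ; left∈E  = surjective⇒regularEpi {A} {C} {corestriction}
                  (corestriction-mor λ a a′ a≺a′ → [ a , a′ , a≺a′ , refl , refl ])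
                  corestriction-surjective
                  (λ c c′ → Tr-reflect {A} {B} {C} {corestriction} {f} (h !_) factors h-injective ∘ to (≺⇔R c c′))
    ; right∈M = injective⇒mono {C} {B} {h} (λ c c′ → Tr⊆≺ {A} {B} {f} f-mor ∘ to (≺⇔R c c′)) h-injective
    ; factors = factors
    }
    where open FromImageIso {A} {B} {C} {Tr A B f} {f} iso

  trIso-count : ∀ {n₁ n₂ n₃ n₄} → HasCount (λ f → IsMor A B f × TrIso A B C f) n₁ →
                HasCount (IsRegEpi A C) n₂ → HasCount (IsMono C B) n₃ → HasCount (IsAut C) n₄ →
                n₁ * n₄ ≡ n₂ * n₃
  trIso-count = FactorizationCount.count A B C
    (λ {e} → regularEpi⇒surjective {A} {C} {e})
    (λ {m} → mono⇒injective {C} {B} {m})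
    (λ {e} {m} → trIso-compose {e} {m})
    (λ {f} → trIso-factor {f})
    (λ {e} {σ} → regularEpi-∘-aut {e} {σ})
    (λ {m} {σ} → mono-∘-aut {m} {σ})
    (λ {e} {e′ = e′} e-reg _ e′-reg _ σ σe≗e′ _ → regularEpi-comparison {e} {e′} e-reg e′-reg σ σe≗e′)

theoremA30 : (A B C : FinPoset) →
    ((n₁ n₂ n₃ n₄ : ℕ) →
      HasCount (λ f → IsMor A B f × InducedIso A B C f) n₁ →
      HasCount (IsEpi A C) n₂ → HasCount (IsRegMono C B) n₃ → HasCount (IsAut C) n₄ →
      n₁ * n₄ ≡ n₂ * n₃) ×
    ((m₁ m₂ m₃ m₄ : ℕ) →
      HasCount (λ f → IsMor A B f × TrIso A B C f) m₁ →
      HasCount (IsRegEpi A C) m₂ → HasCount (IsMono C B) m₃ → HasCount (IsAut C) m₄ →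
      m₁ * m₄ ≡ m₂ * m₃)
theoremA30 A B C = (λ _ _ _ _ → inducedIso-count A B C) , (λ _ _ _ _ → trIso-count A B C)
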